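{- Let $m\geq 3$ and let $n\geq 4$ be even. For any two distinct vertices lying in the same column of $P_m\Box C_n$, there is a 2-factor of $P_m\Box C_n$ separating them.
   Context: $P_m$ is the path of order $m$ and $C_n$ the cycle of order $n$. The vertices of $P_m\Box C_n$ are $u_{i,j}$ with $0\le i\le m-1$ and $j\in\mathbb{Z}_n$; edges are $[u_{i,j},u_{i,j+1}]$ for all $i,j$ (second index mod $n$) and $[u_{i,j},u_{i+1,j}]$ for $0\le i\le m-2$. The $i$-column is the set $\{u_{i,j}: j\in\mathbb{Z}_n\}$. A 2-factor is a spanning subgraph in which every vertex has valency 2. A 2-factor separates a set $A$ of $k$ vertices if it consists of exactly $k$ cycles and $A$ meets the vertex set of each cycle in exactly one vertex. -}

module Defs where

open import Data.Nat using (ℕ; zero; suc)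
open import Data.Fin using (Fin; toℕ)
open import Data.Product using (_×_; _,_; Σ; ∃; ∃-syntax)
open import Data.Sum using (_⊎_)
open import Data.List using (List)
open import Data.List.Membership.Propositional using (_∈_)
open import Relation.Binary.PropositionalEquality using (_≡_; _≢_)
open import Relation.Binary.Construct.Closure.ReflexiveTransitive using (Star)

-- Vertex u_{i,j} of P_m □ C_n is the pair (i , j), i the column index.
Vertex : ℕ → ℕ → Set
Vertex m n = Fin m × Fin n

CycSucc : {n : ℕ} → Fin n → Fin n → Set
CycSucc {n} j j' = (suc (toℕ j) ≡ toℕ j') ⊎ ((suc (toℕ j) ≡ n) × (toℕ j' ≡ 0))

data Step {m n : ℕ} : Vertex m n → Vertex m n → Set where
  cyc  : ∀ {i j j'} → CycSucc j j' → Step (i , j) (i , j')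
  path : ∀ {i i' j} → suc (toℕ i) ≡ toℕ i' → Step (i , j) (i' , j)

Adj : {m n : ℕ} → Vertex m n → Vertex m n → Set
Adj u v = Step u v ⊎ Step v u

-- A spanning subgraph is given by its edge relation F (on all vertices).
record Subgraph (m n : ℕ) (F : Vertex m n → Vertex m n → Set) : Set where
  field
    symmetric : ∀ u v → F u v → F v u
    edges⊆    : ∀ u v → F u v → Adj u v

Valency2 : {m n : ℕ} → (Vertex m n → Vertex m n → Set) → Set
Valency2 {m} {n} F =
  ∀ (v : Vertex m n) → Σ (Vertex m n) λ a → Σ (Vertex m n) λ b →
    a ≢ b × F v a × F v b × (∀ x → F v x → (x ≡ a) ⊎ (x ≡ b))

TwoFactor : (m n : ℕ) → (Vertex m n → Vertex m n → Set) → Set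
TwoFactor m n F = Subgraph m n F × Valency2 F

Connected : {m n : ℕ} → (Vertex m n → Vertex m n → Set) → Vertex m n → Vertex m n → Set
Connected F = Star F

-- F separates the set A (listed without repetition): every cycle (component)
-- of F contains exactly one vertex of A.  Equivalently each vertex v is
-- connected to exactly one element of A; then the components of F are in
-- bijection with A, so F consists of exactly |A| cycles, each meeting A once.
Separates : {m n : ℕ} → (Vertex m n → Vertex m n → Set) → List (Vertex m n) → Set
Separates {m} {n} F A =
  ∀ (v : Vertex m n) → Σ (Vertex m n) λ a →
    a ∈ A × Connected F v a × (∀ b → b ∈ A → Connected F v b → b ≡ a)

{-# OPTIONS --safe #-}
module Submission where

-- Call j the row of u_{i,j}. Cut the rows into the bands {0, 1} and {2, …, n − 1}; both have an
-- even number of rows, so each carries a Hamiltonian cycle that zigzags row by row through the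
-- columns 1, …, m − 1 and returns along column 0. These two cycles form a 2-factor separating any
-- vertex of the first band from any vertex of the second. The rotations of C_n are automorphisms,
-- and one of them moves two distinct vertices of a column to (i, 0), (i, j′) with j′ ≥ 2, or to
-- (i, n − 1), (i, 0).

open import Defs
open import Data.Bool using (Bool; true; false; not; if_then_else_; T)
open import Data.Bool.Properties using (not-involutive; ¬-not) renaming (_≟_ to _≟ᵇ_)
open import Data.Fin using (Fin; zero; suc; toℕ; fromℕ; fromℕ<; inject₁; lower₁)
open import Data.Fin.Induction using (<-weakInduction)
open import Data.Fin.Properties
  using (toℕ-injective; toℕ<n; toℕ≤pred[n]; toℕ-fromℕ; toℕ-fromℕ<; toℕ-inject₁; toℕ-lower₁)
open import Data.List using (_∷_; []; map)
open import Data.List.Membership.Propositional using (_∈_)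
open import Data.List.Membership.Propositional.Properties using (∈-map⁺; ∈-map⁻)
open import Data.List.Relation.Unary.Any using (here; there)
open import Data.Nat using (ℕ; zero; suc; pred; _≤_; _<_; z≤n; s≤s; _≡ᵇ_; _+_; _*_; _∸_)
open import Data.Nat.Divisibility using (_∣_; divides)
open import Data.Nat.Induction using (<-wellFounded)
open import Data.Nat.Properties
open import Data.Product using (_×_; _,_; ∃; proj₁; proj₂)
open import Data.Sum using (_⊎_; inj₁; inj₂) renaming (map to ⊎-map; swap to ⊎-swap)
open import Function using (id; _∘_; _on_; _↔_; Inverse; mk↔ₛ′)
open import Induction.WellFounded using (Acc; acc)
open import Level using (0ℓ)
open import Relation.Binary using (Rel)
open import Relation.Binary.Construct.Closure.ReflexiveTransitive
  using (Star; ε; _◅_; _◅◅_; gmap; fold; reverse)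
open import Relation.Binary.PropositionalEquality
open import Relation.Nullary using (yes; no; contradiction)
open import Relation.Nullary.Decidable using (dec-true; dec-false)

module _ {A : Set} {R : Rel A 0ℓ} (f : A → A) (step : ∀ x → R x (f x))
         (potential : A → ℕ) {Sink : A → Set}
         (descends : ∀ x → Sink x ⊎ potential (f x) < potential x) where

  iterate-reaches-sink : ∀ x → ∃ λ y → Sink y × Star R x y
  iterate-reaches-sink x = go x (<-wellFounded (potential x))
    where
    go : ∀ x → Acc _<_ (potential x) → ∃ λ y → Sink y × Star R x y
    go x (acc rec) with descends x
    ... | inj₁ sink = x , sink , ε
    ... | inj₂ lt   with go (f x) (rec lt)
    ...   | y , sink , walk = y , sink , step x ◅ walk

SeparatingTwoFactor : (m n : ℕ) → Vertex m n → Vertex m n → Set₁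
SeparatingTwoFactor m n x y =
  ∃ λ (F : Rel (Vertex m n) 0ℓ) → TwoFactor m n F × Separates F (x ∷ y ∷ [])

module _ {m n : ℕ} where

  private
    V = Vertex m n

  SuccessorGraph : V ↔ V → Rel V 0ℓ
  SuccessorGraph σ u v = v ≡ Inverse.to σ u ⊎ u ≡ Inverse.to σ v

  successorGraph-twoFactor : (σ : V ↔ V) → let open Inverse σ in
    (∀ v → to v ≢ from v) → (∀ v → Adj v (to v)) → TwoFactor m n (SuccessorGraph σ)
  successorGraph-twoFactor σ to≢from adj-to =
    record { symmetric = λ _ _ → ⊎-swap ; edges⊆ = edges } ,
    λ v → to v , from v , to≢from v , inj₁ refl , inj₂ (sym (strictlyInverseˡ v)) , only-two v
    where
    open Inverse σ
    edges : ∀ u v → SuccessorGraph σ u v → Adj u v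
    edges u _ (inj₁ refl) = adj-to u
    edges _ v (inj₂ refl) = ⊎-swap (adj-to v)
    only-two : ∀ v x → SuccessorGraph σ v x → x ≡ to v ⊎ x ≡ from v
    only-two v x (inj₁ x≡tov) = inj₁ x≡tov
    only-two v x (inj₂ refl)  = inj₂ (sym (strictlyInverseʳ x))

  separates-by-invariant : ∀ {F : Rel V 0ℓ} (side : V → Bool) {x y} →
    (∀ {v w} → Star F v w → side v ≡ side w) →
    (∀ {v w} → side v ≡ side w → Star F v w) →
    side x ≢ side y → Separates F (x ∷ y ∷ [])
  separates-by-invariant side {x} {y} invariant connected x≢y v with side v ≟ᵇ side x
  ... | yes v~x = x , here refl , connected v~x , unique
    where
    unique : ∀ b → b ∈ x ∷ y ∷ [] → Star _ v b → b ≡ x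
    unique b (here b≡x) _ = b≡x
    unique b (there (here refl)) v⇝y = contradiction (trans (sym v~x) (invariant v⇝y)) x≢y
  ... | no v≁x = y , there (here refl) , connected v~y , unique
    where
    v~y : side v ≡ side y
    v~y = trans (¬-not v≁x) (sym (¬-not (x≢y ∘ sym)))
    unique : ∀ b → b ∈ x ∷ y ∷ [] → Star _ v b → b ≡ y
    unique b (here refl) v⇝x = contradiction (invariant v⇝x) v≁x
    unique b (there (here b≡y)) _ = b≡y

  module _ (φ : V ↔ V) where
    open Inverse φ

    twoFactor-image : ∀ {F} → (∀ {u v} → Adj u v → Adj (to u) (to v)) →
      TwoFactor m n F → TwoFactor m n (F on from)
    twoFactor-image {F} adj-to (subgraph , valency) =
      record { symmetric = λ u v → Subgraph.symmetric subgraph (from u) (from v) ; edges⊆ = edges } ,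
      valency′
      where
      edges : ∀ u v → F (from u) (from v) → Adj u v
      edges u v f = subst₂ Adj (strictlyInverseˡ u) (strictlyInverseˡ v)
                      (adj-to (Subgraph.edges⊆ subgraph (from u) (from v) f))
      valency′ : Valency2 (F on from)
      valency′ v with valency (from v)
      ... | a , b , a≢b , Fva , Fvb , only-two =
        to a , to b , a≢b ∘ to-injective , into Fva , into Fvb , only-two′
        where
        into : ∀ {w} → F (from v) w → F (from v) (from (to w))
        into {w} = subst (F (from v)) (sym (strictlyInverseʳ w))
        to-injective : to a ≡ to b → a ≡ b
        to-injective e = trans (sym (strictlyInverseʳ a)) (trans (cong from e) (strictlyInverseʳ b))
        only-two′ : ∀ x → F (from v) (from x) → x ≡ to a ⊎ x ≡ to b
        only-two′ x f with only-two (from x) f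
        ... | inj₁ e = inj₁ (trans (sym (strictlyInverseˡ x)) (cong to e))
        ... | inj₂ e = inj₂ (trans (sym (strictlyInverseˡ x)) (cong to e))

    separates-image : ∀ {F A} → Separates F A → Separates (F on from) (map to A)
    separates-image {F} {A} sep v with sep (from v)
    ... | a , a∈A , v⇝a , unique =
      to a , ∈-map⁺ to a∈A ,
      subst (λ w → Star (F on from) w (to a)) (strictlyInverseˡ v) (gmap to into v⇝a) ,
      unique′
      where
      into : ∀ {u w} → F u w → F (from (to u)) (from (to w))
      into {u} {w} = subst₂ F (sym (strictlyInverseʳ u)) (sym (strictlyInverseʳ w))
      unique′ : ∀ b → b ∈ map to A → Star (F on from) v b → b ≡ to a
      unique′ b b∈ v⇝b with ∈-map⁻ to b∈
      ... | b′ , b′∈A , refl =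
        cong to (unique b′ b′∈A (subst (Star F (from v)) (strictlyInverseʳ b′) (gmap from id v⇝b)))

    separatingTwoFactor-image : (∀ {u v} → Adj u v → Adj (to u) (to v)) →
      ∀ {x y} → SeparatingTwoFactor m n x y → SeparatingTwoFactor m n (to x) (to y)
    separatingTwoFactor-image adj-to (F , twoFactor , sep) =
      (F on from) , twoFactor-image adj-to twoFactor , separates-image sep

rotate : ∀ {n} → Fin (suc n) → Fin (suc n)
rotate {n} j with toℕ j ≟ n
... | yes _   = zero
... | no j≢n = suc (lower₁ j (j≢n ∘ sym))

rotate⁻¹ : ∀ {n} → Fin (suc n) → Fin (suc n)
rotate⁻¹ {n} zero    = fromℕ n
rotate⁻¹     (suc j) = inject₁ j

rotate-last : ∀ {n} (j : Fin (suc n)) → toℕ j ≡ n → rotate j ≡ zero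
rotate-last {n} j j≡n with toℕ j ≟ n
... | yes _   = refl
... | no j≢n = contradiction j≡n j≢n

toℕ-rotate : ∀ {n} (j : Fin (suc n)) → toℕ j ≢ n → toℕ (rotate j) ≡ suc (toℕ j)
toℕ-rotate {n} j j≢n with toℕ j ≟ n
... | yes j≡n = contradiction j≡n j≢n
... | no j≢n′ = cong suc (toℕ-lower₁ j (j≢n′ ∘ sym))

rotate-fromℕ : ∀ n → rotate (fromℕ n) ≡ zero
rotate-fromℕ n = rotate-last (fromℕ n) (toℕ-fromℕ n)

rotate-inject₁ : ∀ {n} (j : Fin n) → rotate (inject₁ j) ≡ suc j
rotate-inject₁ j =
  toℕ-injective (trans (toℕ-rotate (inject₁ j) inject₁≢n) (cong suc (toℕ-inject₁ j)))
  where
  inject₁≢n : toℕ (inject₁ j) ≢ _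
  inject₁≢n e = <-irrefl (trans (sym (toℕ-inject₁ j)) e) (toℕ<n j)

rotate-rotate⁻¹ : ∀ {n} (j : Fin (suc n)) → rotate (rotate⁻¹ j) ≡ j
rotate-rotate⁻¹ {n} zero    = rotate-fromℕ n
rotate-rotate⁻¹     (suc j) = rotate-inject₁ j

rotate⁻¹-rotate : ∀ {n} (j : Fin (suc n)) → rotate⁻¹ (rotate j) ≡ j
rotate⁻¹-rotate {n} j with toℕ j ≟ n
... | yes j≡n = toℕ-injective (trans (toℕ-fromℕ n) (sym j≡n))
... | no j≢n = toℕ-injective (trans (toℕ-inject₁ _) (toℕ-lower₁ j (j≢n ∘ sym)))

cycSucc-rotate : ∀ {n} (j : Fin (suc n)) → CycSucc j (rotate j)
cycSucc-rotate {n} j with toℕ j ≟ n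
... | yes j≡n = inj₂ (cong suc j≡n , refl)
... | no j≢n = inj₁ (cong suc (sym (toℕ-lower₁ j (j≢n ∘ sym))))

cycSucc⇒≡rotate : ∀ {n} {j j′ : Fin (suc n)} → CycSucc j j′ → j′ ≡ rotate j
cycSucc⇒≡rotate {n} {j} {j′} (inj₁ j′≡1+j) =
  toℕ-injective (trans (sym j′≡1+j) (sym (toℕ-rotate j j≢n)))
  where
  j≢n : toℕ j ≢ n
  j≢n j≡n = <-irrefl (trans (sym j′≡1+j) (cong suc j≡n)) (toℕ<n j′)
cycSucc⇒≡rotate {j = j} (inj₂ (1+j≡1+n , j′≡0)) =
  trans (toℕ-injective j′≡0) (sym (rotate-last j (suc-injective 1+j≡1+n)))

rotation : ∀ {m n} → Vertex m (suc n) ↔ Vertex m (suc n)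
rotation = mk↔ₛ′ (λ (i , j) → i , rotate j) (λ (i , j) → i , rotate⁻¹ j)
                 (λ (i , j) → cong (i ,_) (rotate-rotate⁻¹ j))
                 (λ (i , j) → cong (i ,_) (rotate⁻¹-rotate j))

rotation-step : ∀ {m n} {u v : Vertex m (suc n)} →
  Step u v → Step (Inverse.to rotation u) (Inverse.to rotation v)
rotation-step (cyc {j = j} j→j′) rewrite cycSucc⇒≡rotate j→j′ = cyc (cycSucc-rotate (rotate j))
rotation-step (path i→i′) = path i→i′

rotation-adj : ∀ {m n} {u v : Vertex m (suc n)} →
  Adj u v → Adj (Inverse.to rotation u) (Inverse.to rotation v)
rotation-adj = ⊎-map rotation-step rotation-step

even : ℕ → Bool
even zero    = true
even (suc n) = not (even n)

even-*2 : ∀ q → even (q * 2) ≡ true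
even-*2 zero = refl
even-*2 (suc q) rewrite even-*2 q = refl

even-suc⁻¹ : ∀ t {b} → even (suc t) ≡ b → even t ≡ not b
even-suc⁻¹ t e = trans (sym (not-involutive (even t))) (cong not e)

≡ᵇ-refl : ∀ n → (n ≡ᵇ n) ≡ true
≡ᵇ-refl n = dec-true (n ≟ n) refl

≢⇒≡ᵇ-false : ∀ {m n} → m ≢ n → (m ≡ᵇ n) ≡ false
≢⇒≡ᵇ-false {m} {n} = dec-false (m ≟ n)

≡ᵇ-true⇒≡ : ∀ {m n} → (m ≡ᵇ n) ≡ true → m ≡ n
≡ᵇ-true⇒≡ {m} {n} e = ≡ᵇ⇒≡ m n (subst T (sym e) _)

≡ᵇ-false⇒≢ : ∀ {m n} → (m ≡ᵇ n) ≡ false → m ≢ n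
≡ᵇ-false⇒≢ {m} e refl = contradiction (trans (sym e) (≡ᵇ-refl m)) λ ()

GridStep : Rel (ℕ × ℕ) 0ℓ
GridStep (c , t) (c′ , t′) = (c′ ≡ suc c × t′ ≡ t) ⊎ (c′ ≡ c × t′ ≡ suc t)

GridAdj : Rel (ℕ × ℕ) 0ℓ
GridAdj p q = GridStep p q ⊎ GridStep q p

InBox : ℕ → ℕ → ℕ × ℕ → Set
InBox M N (c , t) = c ≤ M × t ≤ N

-- The box [0, M] × [0, N] of points (column, row) is cut into horizontal bands, each running from
-- a bottom row to the next row t with top t; top rows are odd, so every band has an even number
-- of rows. next runs through each band as a cycle: rightwards on even rows and leftwards on odd
-- rows of the columns 1 … M, then back down column 0.
module BandSnake (M N : ℕ) (top : ℕ → Bool) (1≤M : 1 ≤ M)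
  (top⇒odd : ∀ t → top t ≡ true → even t ≡ false) (top-N : top N ≡ true) where

  bottom : ℕ → Bool
  bottom zero    = true
  bottom (suc t) = top t

  next : ℕ × ℕ → ℕ × ℕ
  next (zero , t)  = if bottom t then (1 , t) else (0 , pred t)
  next (suc c , t) =
    if even t then (if suc c ≡ᵇ M then (M , suc t) else (suc (suc c) , t))
    else (if c ≡ᵇ 0 then (if top t then (0 , t) else (1 , suc t)) else (c , t))

  prev : ℕ × ℕ → ℕ × ℕ
  prev (zero , t)  = if top t then (1 , t) else (0 , suc t)
  prev (suc c , t) =
    if even t then (if c ≡ᵇ 0 then (if bottom t then (0 , t) else (1 , pred t)) else (c , t))
    else (if suc c ≡ᵇ M then (M , pred t) else (suc (suc c) , t))

  bottom⇒even : ∀ t → bottom t ≡ true → even t ≡ true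
  bottom⇒even zero    _ = refl
  bottom⇒even (suc t) e rewrite top⇒odd t e = refl

  even⇒¬top : ∀ t → even t ≡ true → top t ≡ false
  even⇒¬top t e with top t in e′
  ... | true  = contradiction (trans (sym e) (top⇒odd t e′)) λ ()
  ... | false = refl

  ¬top⇒<N : ∀ {t} → t ≤ N → top t ≡ false → t < N
  ¬top⇒<N t≤N e = ≤∧≢⇒< t≤N λ { refl → contradiction (trans (sym e) top-N) λ () }

  even⇒<N : ∀ {t} → t ≤ N → even t ≡ true → t < N
  even⇒<N {t} t≤N e = ¬top⇒<N t≤N (even⇒¬top t e)

  prev-next : ∀ c t → c ≤ M → prev (next (c , t)) ≡ (c , t)
  prev-next zero zero _ = refl
  prev-next zero (suc t) _ with top t in e
  ... | true  rewrite top⇒odd t e | e = refl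
  ... | false rewrite e = refl
  prev-next (suc c) t _ with even t in e
  prev-next (suc c) t _ | true with suc c ≡ᵇ M in e′
  ... | true with ≡ᵇ-true⇒≡ {suc c} {M} e′
  ...   | refl rewrite e | ≡ᵇ-refl c = refl
  prev-next (suc c) t _ | true | false rewrite e = refl
  prev-next (suc zero) t _ | false with top t in e′
  ... | true  rewrite e′ = refl
  ... | false rewrite e | e′ = refl
  prev-next (suc (suc c)) t c<M | false rewrite e | ≢⇒≡ᵇ-false (<⇒≢ c<M) = refl

  next-prev : ∀ c t → c ≤ M → next (prev (c , t)) ≡ (c , t)
  next-prev zero t _ with top t in e
  ... | true  rewrite top⇒odd t e | e = refl
  ... | false rewrite e = refl
  next-prev (suc c) t _ with even t in e
  next-prev (suc zero) t _ | true with bottom t in b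
  ... | true rewrite b = refl
  next-prev (suc zero) zero _ | true | false = contradiction b λ ()
  next-prev (suc zero) (suc t) _ | true | false rewrite even-suc⁻¹ t e | b = refl
  next-prev (suc (suc c)) t c<M | true rewrite e | ≢⇒≡ᵇ-false (<⇒≢ c<M) = refl
  next-prev (suc c) t _ | false with suc c ≡ᵇ M in e′
  next-prev (suc c) zero _ | false | true = contradiction e λ ()
  next-prev (suc c) (suc t) _ | false | true with ≡ᵇ-true⇒≡ {suc c} {M} e′
  ... | refl rewrite even-suc⁻¹ t e | ≡ᵇ-refl c = refl
  next-prev (suc c) t _ | false | false rewrite e = refl

  next-inBox : ∀ p → InBox M N p → InBox M N (next p)
  next-inBox (zero , t) (_ , t≤N) with bottom t
  ... | true  = 1≤M , t≤N
  ... | false = z≤n , ≤-trans pred[n]≤n t≤N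
  next-inBox (suc c , t) (c<M , t≤N) with even t in e
  next-inBox (suc c , t) (c<M , t≤N) | true with suc c ≡ᵇ M in e′
  ... | true  = ≤-refl , even⇒<N t≤N e
  ... | false = ≤∧≢⇒< c<M (≡ᵇ-false⇒≢ e′) , t≤N
  next-inBox (suc zero , t) (c<M , t≤N) | false with top t in e′
  ... | true  = z≤n , t≤N
  ... | false = 1≤M , ¬top⇒<N t≤N e′
  next-inBox (suc (suc c) , t) (c<M , t≤N) | false = <⇒≤ c<M , t≤N

  prev-inBox : ∀ p → InBox M N p → InBox M N (prev p)
  prev-inBox (zero , t) (_ , t≤N) with top t in e
  ... | true  = 1≤M , t≤N
  ... | false = z≤n , ¬top⇒<N t≤N e
  prev-inBox (suc c , t) (c<M , t≤N) with even t
  prev-inBox (suc zero , t) (c<M , t≤N) | true with bottom t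
  ... | true  = z≤n , t≤N
  ... | false = 1≤M , ≤-trans pred[n]≤n t≤N
  prev-inBox (suc (suc c) , t) (c<M , t≤N) | true = <⇒≤ c<M , t≤N
  prev-inBox (suc c , t) (c<M , t≤N) | false with suc c ≡ᵇ M in e′
  ... | true  = ≤-refl , ≤-trans pred[n]≤n t≤N
  ... | false = ≤∧≢⇒< c<M (≡ᵇ-false⇒≢ e′) , t≤N

  next≢prev : ∀ p → next p ≢ prev p
  next≢prev (zero , t) with bottom t in b | top t in e
  ... | true  | true  = contradiction (trans (sym (bottom⇒even t b)) (top⇒odd t e)) λ ()
  ... | true  | false = λ ()
  ... | false | true  = λ ()
  next≢prev (zero , zero)  | false | false = contradiction b λ ()
  next≢prev (zero , suc t) | false | false = λ ()
  next≢prev (suc c , t) with even t in e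
  next≢prev (suc zero , t) | true with 1 ≡ᵇ M | bottom t in b
  ... | true  | true  = m<n⇒n≢0 1≤M ∘ cong proj₁
  ... | false | true  = λ ()
  ... | false | false = λ ()
  next≢prev (suc zero , zero)  | true | true | false = contradiction b λ ()
  next≢prev (suc zero , suc t) | true | true | false = λ ()
  next≢prev (suc (suc c) , t) | true with suc (suc c) ≡ᵇ M
  ... | true  = λ ()
  ... | false = λ ()
  next≢prev (suc c , zero) | false = contradiction e λ ()
  next≢prev (suc zero , suc t) | false with top (suc t) | 1 ≡ᵇ M
  ... | true  | true  = λ ()
  ... | true  | false = λ ()
  ... | false | true  = λ ()
  ... | false | false = λ ()
  next≢prev (suc (suc c) , suc t) | false with suc (suc c) ≡ᵇ M
  ... | true  = λ ()
  ... | false = λ ()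

  next-adjacent : ∀ p → GridAdj p (next p)
  next-adjacent (zero , t) with bottom t in b
  ... | true = inj₁ (inj₁ (refl , refl))
  next-adjacent (zero , zero)  | false = contradiction b λ ()
  next-adjacent (zero , suc t) | false = inj₂ (inj₂ (refl , refl))
  next-adjacent (suc c , t) with even t
  next-adjacent (suc c , t) | true with suc c ≡ᵇ M in e′
  ... | true  = inj₁ (inj₂ (sym (≡ᵇ-true⇒≡ {suc c} {M} e′) , refl))
  ... | false = inj₁ (inj₁ (refl , refl))
  next-adjacent (suc zero , t) | false with top t
  ... | true  = inj₂ (inj₁ (refl , refl))
  ... | false = inj₁ (inj₂ (refl , refl))
  next-adjacent (suc (suc c) , t) | false = inj₂ (inj₁ (refl , refl))

  next-band : ∀ {B : Set} (band : ℕ → B) → (∀ t → top t ≡ false → band (suc t) ≡ band t) →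
              ∀ p → band (proj₂ (next p)) ≡ band (proj₂ p)
  next-band band cross (zero , zero) = refl
  next-band band cross (zero , suc t) with top t in e
  ... | true  = refl
  ... | false = sym (cross t e)
  next-band band cross (suc c , t) with even t in e
  next-band band cross (suc c , t) | true with suc c ≡ᵇ M
  ... | true  = cross t (even⇒¬top t e)
  ... | false = refl
  next-band band cross (suc zero , t) | false with top t in e′
  ... | true  = refl
  ... | false = cross t e′
  next-band band cross (suc (suc c) , t) | false = refl

  IsCorner : ℕ × ℕ → Set
  IsCorner (c , t) = c ≡ 0 × bottom t ≡ true

  -- Decreases along next until the bottom of column 0 is reached: column 0 lies below all other
  -- points, row t of the columns 1 … M is weighted by N ∸ t, and inside a row the order is that
  -- of travel.
  potential : ℕ × ℕ → ℕ
  potential (zero , t)  = t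
  potential (suc c , t) = suc N + ((N ∸ t) * M + (if even t then M ∸ suc c else c))

  climb : ∀ {t r} → t < N → r < M → (N ∸ suc t) * M + r < (N ∸ t) * M
  climb {t} {r} t<N r<M = begin-strict
    (N ∸ suc t) * M + r  <⟨ +-monoʳ-< _ r<M ⟩
    (N ∸ suc t) * M + M  ≡⟨ +-comm _ M ⟩
    suc (N ∸ suc t) * M  ≡⟨ cong (_* M) (+-∸-assoc 1 t<N) ⟨
    (N ∸ t) * M          ∎
    where open ≤-Reasoning

  next-descends : ∀ p → InBox M N p → IsCorner p ⊎ potential (next p) < potential p
  next-descends (zero , t) _ with bottom t in b
  ... | true = inj₁ (refl , refl)
  next-descends (zero , zero)  _ | false = contradiction b λ ()
  next-descends (zero , suc t) _ | false = inj₂ (n<1+n t)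
  next-descends (suc c , t) (c<M , t≤N) with even t in e
  next-descends (suc c , t) (c<M , t≤N) | true with suc c ≡ᵇ M in e′
  ... | true with ≡ᵇ-true⇒≡ {suc c} {M} e′
  ...   | refl rewrite e | n∸n≡0 c | +-identityʳ ((N ∸ t) * suc c) =
          inj₂ (+-monoʳ-< (suc N) (climb (even⇒<N t≤N e) ≤-refl))
  next-descends (suc c , t) (c<M , t≤N) | true | false rewrite e =
    inj₂ (+-monoʳ-< (suc N) (+-monoʳ-< ((N ∸ t) * M)
      (∸-monoʳ-< ≤-refl (≤∧≢⇒< c<M (≡ᵇ-false⇒≢ e′)))))
  next-descends (suc zero , t) (c<M , t≤N) | false with top t in e′
  ... | true  = inj₂ (≤-trans (s≤s t≤N) (m≤m+n (suc N) _))
  ... | false rewrite e | +-identityʳ ((N ∸ t) * M) =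
          inj₂ (+-monoʳ-< (suc N) (climb (¬top⇒<N t≤N e′) (∸-monoʳ-< ≤-refl 1≤M)))
  next-descends (suc (suc c) , t) (c<M , t≤N) | false rewrite e =
    inj₂ (+-monoʳ-< (suc N) (+-monoʳ-< ((N ∸ t) * M) ≤-refl))

module Box {M N : ℕ} where

  private
    V = Vertex (suc M) (suc N)

  point : V → ℕ × ℕ
  point (i , j) = toℕ i , toℕ j

  point-inBox : ∀ v → InBox M N (point v)
  point-inBox (i , j) = toℕ≤pred[n] i , toℕ≤pred[n] j

  vertex : ∀ p → InBox M N p → V
  vertex (c , t) (c≤M , t≤N) = fromℕ< (s≤s c≤M) , fromℕ< (s≤s t≤N)

  point-vertex : ∀ p (inBox : InBox M N p) → point (vertex p inBox) ≡ p
  point-vertex (c , t) (c≤M , t≤N) =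
    cong₂ _,_ (toℕ-fromℕ< (s≤s c≤M)) (toℕ-fromℕ< (s≤s t≤N))

  point-injective : ∀ {u v} → point u ≡ point v → u ≡ v
  point-injective {i , j} {i′ , j′} e =
    cong₂ _,_ (toℕ-injective (cong proj₁ e)) (toℕ-injective (cong proj₂ e))

  gridStep⇒step : ∀ {u v} → GridStep (point u) (point v) → Step u v
  gridStep⇒step {_ , j} {_ , j′} (inj₁ (i′≡1+i , j′≡j))
    rewrite toℕ-injective {i = j′} {j} j′≡j = path (sym i′≡1+i)
  gridStep⇒step {i , _} {i′ , _} (inj₂ (i′≡i , j′≡1+j))
    rewrite toℕ-injective {i = i′} {i} i′≡i = cyc (inj₁ (sym j′≡1+j))

  gridAdj⇒adj : ∀ {u v} → GridAdj (point u) (point v) → Adj u v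
  gridAdj⇒adj = ⊎-map gridStep⇒step gridStep⇒step

  restrict : (f : ℕ × ℕ → ℕ × ℕ) → (∀ p → InBox M N p → InBox M N (f p)) → V → V
  restrict f f-inBox v = vertex (f (point v)) (f-inBox (point v) (point-inBox v))

  point-restrict : ∀ f f-inBox v → point (restrict f f-inBox v) ≡ f (point v)
  point-restrict f f-inBox v = point-vertex _ (f-inBox (point v) (point-inBox v))

  restrict-inverse : ∀ f g f-inBox g-inBox → (∀ p → InBox M N p → f (g p) ≡ p) →
                     ∀ v → restrict f f-inBox (restrict g g-inBox v) ≡ v
  restrict-inverse f g f-inBox g-inBox f∘g v = point-injective (begin
    point (restrict f f-inBox (restrict g g-inBox v)) ≡⟨ point-restrict f f-inBox _ ⟩
    f (point (restrict g g-inBox v))                  ≡⟨ cong f (point-restrict g g-inBox v) ⟩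
    f (g (point v))                                   ≡⟨ f∘g (point v) (point-inBox v) ⟩
    point v                                           ∎)
    where open ≡-Reasoning

  boxPermutation : (f g : ℕ × ℕ → ℕ × ℕ) →
    (f-inBox : ∀ p → InBox M N p → InBox M N (f p)) →
    (g-inBox : ∀ p → InBox M N p → InBox M N (g p)) →
    (∀ p → InBox M N p → f (g p) ≡ p) → (∀ p → InBox M N p → g (f p) ≡ p) → V ↔ V
  boxPermutation f g f-inBox g-inBox f∘g g∘f =
    mk↔ₛ′ (restrict f f-inBox) (restrict g g-inBox)
          (restrict-inverse f g f-inBox g-inBox f∘g) (restrict-inverse g f g-inBox f-inBox g∘f)

twoBandTop : ℕ → ℕ → Bool
twoBandTop N (suc zero) = true
twoBandTop N t          = t ≡ᵇ N

twoBandTop-odd : ∀ {N} → even N ≡ false → ∀ t → twoBandTop N t ≡ true → even t ≡ false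
twoBandTop-odd oddN (suc zero)    _ = refl
twoBandTop-odd {N} oddN zero          e =
  subst (λ t → even t ≡ false) (sym (≡ᵇ-true⇒≡ {0} {N} e)) oddN
twoBandTop-odd {N} oddN (suc (suc t)) e =
  subst (λ t → even t ≡ false) (sym (≡ᵇ-true⇒≡ {suc (suc t)} {N} e)) oddN

twoBandTop-last : ∀ N → twoBandTop N N ≡ true
twoBandTop-last zero          = refl
twoBandTop-last (suc zero)    = refl
twoBandTop-last (suc (suc N)) = ≡ᵇ-refl N

lowerBand : ℕ → Bool
lowerBand zero          = true
lowerBand (suc zero)    = true
lowerBand (suc (suc _)) = false

corner : Bool → ℕ × ℕ
corner true  = 0 , 0
corner false = 0 , 2

module TwoBands {M N : ℕ} (1≤M : 1 ≤ M) (oddN : even N ≡ false) where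

  open BandSnake M N (twoBandTop N) 1≤M (twoBandTop-odd oddN) (twoBandTop-last N)
  open Box {M} {N}

  lowerBand-cross : ∀ t → twoBandTop N t ≡ false → lowerBand (suc t) ≡ lowerBand t
  lowerBand-cross zero          _ = refl
  lowerBand-cross (suc zero)    ()
  lowerBand-cross (suc (suc t)) _ = refl

  isCorner⇒corner : ∀ p → InBox M N p → IsCorner p → p ≡ corner (lowerBand (proj₂ p))
  isCorner⇒corner (zero , zero)                _ _ = refl
  isCorner⇒corner (zero , suc zero)            _ (_ , e) =
    contradiction (subst (λ n → even n ≡ false) (sym (≡ᵇ-true⇒≡ {0} {N} e)) oddN) λ ()
  isCorner⇒corner (zero , suc (suc zero))      _ _ = refl
  isCorner⇒corner (zero , suc (suc (suc t))) (_ , t≤N) (_ , e) =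
    contradiction (subst (suc (suc (suc t)) ≤_) (sym (≡ᵇ-true⇒≡ {suc (suc t)} {N} e)) t≤N)
                  (<-irrefl refl)

  private
    V = Vertex (suc M) (suc N)

  snake : V ↔ V
  snake = boxPermutation next prev next-inBox prev-inBox
    (λ (c , t) (c≤M , _) → next-prev c t c≤M) (λ (c , t) (c≤M , _) → prev-next c t c≤M)

  open Inverse snake

  F : V → V → Set
  F = SuccessorGraph snake

  point-to : ∀ v → point (to v) ≡ next (point v)
  point-to = point-restrict next next-inBox

  point-from : ∀ v → point (from v) ≡ prev (point v)
  point-from = point-restrict prev prev-inBox

  twoFactor : TwoFactor (suc M) (suc N) F
  twoFactor = successorGraph-twoFactor snake to≢from adjacent
    where
    to≢from : ∀ v → to v ≢ from v
    to≢from v e =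
      next≢prev (point v) (trans (sym (point-to v)) (trans (cong point e) (point-from v)))
    adjacent : ∀ v → Adj v (to v)
    adjacent v =
      gridAdj⇒adj (subst (GridAdj (point v)) (sym (point-to v)) (next-adjacent (point v)))

  side : V → Bool
  side v = lowerBand (proj₂ (point v))

  side-to : ∀ v → side (to v) ≡ side v
  side-to v =
    trans (cong (lowerBand ∘ proj₂) (point-to v)) (next-band lowerBand lowerBand-cross (point v))

  side-invariant : ∀ {v w} → Star F v w → side v ≡ side w
  side-invariant = fold (λ v w → side v ≡ side w) (λ f e → trans (edge f) e) refl
    where
    edge : ∀ {u w} → F u w → side u ≡ side w
    edge {u} (inj₁ refl) = sym (side-to u)
    edge {w = w} (inj₂ refl) = side-to w

  reaches-corner : ∀ v → ∃ λ c → point c ≡ corner (side v) × Star F v c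
  reaches-corner v with iterate-reaches-sink to (λ _ → inj₁ refl) (potential ∘ point) descends v
    where
    descends : ∀ v → IsCorner (point v) ⊎ potential (point (to v)) < potential (point v)
    descends v rewrite point-to v = next-descends (point v) (point-inBox v)
  ... | c , isCorner , v⇝c =
    c ,
    trans (isCorner⇒corner (point c) (point-inBox c) isCorner) (cong corner (sym (side-invariant v⇝c))) ,
    v⇝c

  side-connected : ∀ {v w} → side v ≡ side w → Star F v w
  side-connected {v} {w} v~w with reaches-corner v | reaches-corner w
  ... | c , c≡ , v⇝c | c′ , c′≡ , w⇝c′
    with point-injective (trans c≡ (trans (cong corner v~w) (sym c′≡)))
  ...   | refl = v⇝c ◅◅ reverse ⊎-swap w⇝c′

  separatingTwoFactor-bands : ∀ x y → side x ≢ side y → SeparatingTwoFactor (suc M) (suc N) x y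
  separatingTwoFactor-bands _ _ x≁y =
    F , twoFactor , separates-by-invariant side side-invariant side-connected x≁y

separatingTwoFactor-rotate : ∀ {m n} {u v : Vertex m (suc n)} → SeparatingTwoFactor m (suc n) u v →
  SeparatingTwoFactor m (suc n) (Inverse.to rotation u) (Inverse.to rotation v)
separatingTwoFactor-rotate = separatingTwoFactor-image rotation rotation-adj

separatingTwoFactor-column : ∀ {M N} → 1 ≤ M → 2 ≤ N → even N ≡ false →
  (i : Fin (suc M)) (j j′ : Fin (suc N)) → j ≢ j′ →
  SeparatingTwoFactor (suc M) (suc N) (i , j) (i , j′)
separatingTwoFactor-column {M} {N} 1≤M (s≤s (s≤s _)) oddN i = <-weakInduction P base step
  where
  open TwoBands {M} {N} 1≤M oddN using (separatingTwoFactor-bands)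

  Separated : Vertex (suc M) (suc N) → Vertex (suc M) (suc N) → Set₁
  Separated = SeparatingTwoFactor (suc M) (suc N)

  P : Fin (suc N) → Set₁
  P j = ∀ j′ → j ≢ j′ → Separated (i , j) (i , j′)

  base : P zero
  base zero          0≢0 = contradiction refl 0≢0
  base (suc zero)    _   = subst₂ (λ j j′ → Separated (i , j) (i , j′)) (rotate-fromℕ N) refl
    (separatingTwoFactor-rotate (separatingTwoFactor-bands (i , fromℕ N) (i , zero) λ ()))
  base (suc (suc j)) _   = separatingTwoFactor-bands (i , zero) (i , suc (suc j)) λ ()

  step : ∀ k → P (inject₁ k) → P (suc k)
  step k hyp j′ k≢j′ =
    subst₂ (λ j j′ → Separated (i , j) (i , j′)) (rotate-inject₁ k) (rotate-rotate⁻¹ j′)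
      (separatingTwoFactor-rotate (hyp (rotate⁻¹ j′) inject₁≢rotate⁻¹))
    where
    inject₁≢rotate⁻¹ : inject₁ k ≢ rotate⁻¹ j′
    inject₁≢rotate⁻¹ e =
      k≢j′ (trans (sym (rotate-inject₁ k)) (trans (cong rotate e) (rotate-rotate⁻¹ j′)))

lemma3p1 : (m n : ℕ) → 3 ≤ m → 4 ≤ n → 2 ∣ n →
    (i : Fin m) (j j' : Fin n) → j ≢ j' →
    ∃ λ (F : Vertex m n → Vertex m n → Set) →
      TwoFactor m n F × Separates F ((i , j) ∷ (i , j') ∷ [])
lemma3p1 (suc M) (suc N) (s≤s 2≤M) (s≤s 3≤N) (divides q n≡q*2) =
  separatingTwoFactor-column (≤-trans (s≤s z≤n) 2≤M) (<⇒≤ 3≤N) oddN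
  where
  oddN : even N ≡ false
  oddN = even-suc⁻¹ N (trans (cong even n≡q*2) (even-*2 q))
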